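{- Let $\mathcal{M}$ be a hereditary class of simple matroids. Then the extension class $\mathcal{M}^e$ is hereditary.
   Context: All matroids are finite and simple. A class $\mathcal{M}$ of matroids is hereditary if it is closed under flats: whenever $M \in \mathcal{M}$ and $F$ is a flat of $M$, the restriction $M|F$ is in $\mathcal{M}$. The extension class $\mathcal{M}^e$ of a hereditary class $\mathcal{M}$ consists of all matroids $M$ such that either $M \in \mathcal{M}$, or $M$ has an element $e$ with $M \setminus e \in \mathcal{M}$. -}

module Defs where

open import Data.Nat using (ℕ; _≤_; _<_; _+_)
open import Data.Fin using (Fin)
open import Data.Fin.Subset using (Subset; _∈_; _∉_; _⊆_; _∪_; _∩_; ⁅_⁆; ∁; ∣_∣)
open import Data.Vec using (tabulate; lookup)
open import Data.Product using (Σ; _×_; ∃)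
open import Data.Sum using (_⊎_)
open import Relation.Binary.PropositionalEquality using (_≡_; _≢_)

-- The ground set E is a
-- subset of a finite "universe" Fin n; the rank function is only
-- constrained (and only meaningful) on subsets of E.  This embedded
-- presentation makes restriction and deletion literally shrink E.
record Matroid : Set where
  field
    n  : ℕ
    E  : Subset n
    r  : Subset n → ℕ
    R1 : ∀ X → X ⊆ E → r X ≤ ∣ X ∣
    R2 : ∀ X Y → X ⊆ Y → Y ⊆ E → r X ≤ r Y
    R3 : ∀ X Y → X ⊆ E → Y ⊆ E → r (X ∪ Y) + r (X ∩ Y) ≤ r X + r Y

open Matroid public

IsFlat : (M : Matroid) → Subset (n M) → Set
IsFlat M F = F ⊆ E M × (∀ e → e ∈ E M → e ∉ F → r M F < r M (F ∪ ⁅ e ⁆))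

Simple : Matroid → Set
Simple M = (∀ e → e ∈ E M → r M ⁅ e ⁆ ≡ 1)
         × (∀ e f → e ∈ E M → f ∈ E M → e ≢ f → r M (⁅ e ⁆ ∪ ⁅ f ⁆) ≡ 2)

restrict : (M : Matroid) (F : Subset (n M)) → F ⊆ E M → Matroid
restrict M F F⊆E = record
  { n  = n M
  ; E  = F
  ; r  = r M
  ; R1 = λ X X⊆F → R1 M X (λ x∈X → F⊆E (X⊆F x∈X))
  ; R2 = λ X Y X⊆Y Y⊆F → R2 M X Y X⊆Y (λ y → F⊆E (Y⊆F y))
  ; R3 = λ X Y X⊆F Y⊆F → R3 M X Y (λ x → F⊆E (X⊆F x)) (λ y → F⊆E (Y⊆F y))
  }

_∣flat_ : (M : Matroid) → Σ (Subset (n M)) (IsFlat M) → Matroid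
M ∣flat (F Data.Product., fl) = restrict M F (Data.Product.proj₁ fl)

_∖_ : (M : Matroid) → Fin (n M) → Matroid
M ∖ e = record
  { n  = n M
  ; E  = E M ∩ ∁ ⁅ e ⁆
  ; r  = r M
  ; R1 = λ X X⊆ → R1 M X (λ x → sub (X⊆ x))
  ; R2 = λ X Y X⊆Y Y⊆ → R2 M X Y X⊆Y (λ y → sub (Y⊆ y))
  ; R3 = λ X Y X⊆ Y⊆ → R3 M X Y (λ x → sub (X⊆ x)) (λ y → sub (Y⊆ y))
  }
  where
  open import Data.Fin.Subset.Properties using (x∈p∩q⁻)
  open import Data.Product using (proj₁)
  sub : ∀ {x} → x ∈ (E M ∩ ∁ ⁅ e ⁆) → x ∈ E M
  sub x∈ = proj₁ (x∈p∩q⁻ (E M) _ x∈)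

-- Isomorphism of matroids: mutually inverse maps between the ground sets
-- preserving rank.  The image of X ⊆ E M under φ is {y ∈ E N ∣ ψ y ∈ X}.
record _≅_ (M N : Matroid) : Set where
  field
    φ   : Fin (n M) → Fin (n N)
    ψ   : Fin (n N) → Fin (n M)
    φ∈  : ∀ x → x ∈ E M → φ x ∈ E N
    ψ∈  : ∀ y → y ∈ E N → ψ y ∈ E M
    ψφ  : ∀ x → x ∈ E M → ψ (φ x) ≡ x
    φψ  : ∀ y → y ∈ E N → φ (ψ y) ≡ y
    rk  : ∀ X → X ⊆ E M → r N (tabulate (λ y → lookup X (ψ y)) ∩ E N) ≡ r M X

Class : Set₁
Class = Matroid → Set

IsoClosed : Class → Set
IsoClosed 𝓜 = ∀ M N → M ≅ N → 𝓜 M → 𝓜 N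

Hereditary : Class → Set
Hereditary 𝓜 = ∀ M → 𝓜 M → (F : Σ (Subset (n M)) (IsFlat M)) → 𝓜 (M ∣flat F)

OfSimple : Class → Set
OfSimple 𝓜 = ∀ M → 𝓜 M → Simple M

Ext : Class → Class
Ext 𝓜 M = Simple M × (𝓜 M ⊎ Σ (Fin (n M)) (λ e → e ∈ E M × 𝓜 (M ∖ e)))

{-# OPTIONS --safe #-}
module Submission where

open import Defs
open import Data.Nat using (ℕ; _≤_; _<_; _+_)
open import Data.Nat.Properties using (+-comm; +-mono-≤; +-monoʳ-<; +-cancelʳ-<; module ≤-Reasoning)
open import Data.Fin using (Fin)
open import Data.Fin.Subset using (Subset; _∈_; _∉_; _⊆_; _∪_; _∩_; ⁅_⁆; ∁)
open import Data.Fin.Subset.Properties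
  using (x∈p∩q⁺; x∈p∩q⁻; p∩q⊆p; p∩q⊆q; p⊆p∪q; q⊆p∪q; x∈p∪q⁻; x∈⁅y⁆⇒x≡y; x∉p⇒x∈∁p; ⊆-antisym; _∈?_)
open import Data.Vec using (tabulate; lookup)
open import Data.Vec.Properties using (tabulate∘lookup)
open import Data.Product using (Σ; _×_; _,_; proj₁)
open import Data.Sum using (_⊎_; inj₁; inj₂)
open import Relation.Nullary using (yes; no)
open import Relation.Binary.PropositionalEquality using (_≡_; refl; cong; subst; sym; trans)

-- If M ∈ 𝓜 then M|F ∈ 𝓜 directly.  Otherwise M \ e ∈ 𝓜, and F − e is a flat of M \ e:
-- by submodularity, every subset of a flat gains rank from each element outside the flat.
-- Hence (M \ e)|(F − e) = (M|F) \ e lies in 𝓜, which puts M|F in 𝓜ᵉ when e ∈ F, and in 𝓜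
-- itself when e ∉ F, since then deleting e changes nothing.

private
  variable
    k : ℕ

∪-lub : {p q s : Subset k} → p ⊆ s → q ⊆ s → p ∪ q ⊆ s
∪-lub {p = p} {q} p⊆s q⊆s x∈p∪q with x∈p∪q⁻ p q x∈p∪q
... | inj₁ x∈p = p⊆s x∈p
... | inj₂ x∈q = q⊆s x∈q

x∈p⇒⁅x⁆⊆p : {x : Fin k} {p : Subset k} → x ∈ p → ⁅ x ⁆ ⊆ p
x∈p⇒⁅x⁆⊆p {x = x} {p} x∈p y∈⁅x⁆ = subst (_∈ p) (sym (x∈⁅y⁆⇒x≡y x y∈⁅x⁆)) x∈p

p⊆q⇒p∩q≡p : {p q : Subset k} → p ⊆ q → p ∩ q ≡ p
p⊆q⇒p∩q≡p {p = p} {q} p⊆q = ⊆-antisym (p∩q⊆p p q) (λ x∈p → x∈p∩q⁺ (x∈p , p⊆q x∈p))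

-- The image of p under the identity map, in the form the rank field of _≅_ computes it.
tabulate∘lookup-∩ : {p q : Subset k} → p ⊆ q → tabulate (lookup p) ∩ q ≡ p
tabulate∘lookup-∩ {p = p} {q} p⊆q = trans (cong (_∩ q) (tabulate∘lookup p)) (p⊆q⇒p∩q≡p p⊆q)

restrict-simple : (M : Matroid) {F : Subset (n M)} (F⊆E : F ⊆ E M) → Simple M → Simple (restrict M F F⊆E)
restrict-simple M F⊆E (loopless , parallel-free) =
  (λ x x∈F → loopless x (F⊆E x∈F)) ,
  (λ x y x∈F y∈F x≢y → parallel-free x y (F⊆E x∈F) (F⊆E y∈F) x≢y)

-- Submodularity applied to A = G ∪ ⁅ x ⁆ and F.
rank-increment-antitone : (M : Matroid) {G F : Subset (n M)} {x : Fin (n M)} →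
  G ⊆ F → F ⊆ E M → x ∈ E M →
  r M G + r M (F ∪ ⁅ x ⁆) ≤ r M (G ∪ ⁅ x ⁆) + r M F
rank-increment-antitone M {G} {F} {x} G⊆F F⊆E x∈E = begin
  r M G + r M (F ∪ ⁅ x ⁆)   ≤⟨ +-mono-≤ (R2 M G (A ∩ F) G⊆A∩F A∩F⊆E)
                                        (R2 M (F ∪ ⁅ x ⁆) (A ∪ F) F∪x⊆A∪F A∪F⊆E) ⟩
  r M (A ∩ F) + r M (A ∪ F) ≡⟨ +-comm (r M (A ∩ F)) (r M (A ∪ F)) ⟩
  r M (A ∪ F) + r M (A ∩ F) ≤⟨ R3 M A F A⊆E F⊆E ⟩
  r M A + r M F             ∎
  where
  open ≤-Reasoning
  A : Subset (n M)
  A = G ∪ ⁅ x ⁆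
  A⊆E : A ⊆ E M
  A⊆E = ∪-lub (λ y∈G → F⊆E (G⊆F y∈G)) (x∈p⇒⁅x⁆⊆p x∈E)
  A∪F⊆E : A ∪ F ⊆ E M
  A∪F⊆E = ∪-lub A⊆E F⊆E
  A∩F⊆E : A ∩ F ⊆ E M
  A∩F⊆E y∈A∩F = F⊆E (p∩q⊆q A F y∈A∩F)
  G⊆A∩F : G ⊆ A ∩ F
  G⊆A∩F y∈G = x∈p∩q⁺ (p⊆p∪q ⁅ x ⁆ y∈G , G⊆F y∈G)
  F∪x⊆A∪F : F ∪ ⁅ x ⁆ ⊆ A ∪ F
  F∪x⊆A∪F = ∪-lub (q⊆p∪q A F) (λ y∈⁅x⁆ → p⊆p∪q F (q⊆p∪q G ⁅ x ⁆ y∈⁅x⁆))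

⊆-flat⇒rank-increases : (M : Matroid) {G F : Subset (n M)} {x : Fin (n M)} →
  IsFlat M F → G ⊆ F → x ∈ E M → x ∉ F → r M G < r M (G ∪ ⁅ x ⁆)
⊆-flat⇒rank-increases M {G} {F} {x} (F⊆E , F-closed) G⊆F x∈E x∉F =
  +-cancelʳ-< (r M F) (r M G) (r M (G ∪ ⁅ x ⁆)) (begin-strict
    r M G + r M F             <⟨ +-monoʳ-< (r M G) (F-closed x x∈E x∉F) ⟩
    r M G + r M (F ∪ ⁅ x ⁆)   ≤⟨ rank-increment-antitone M G⊆F F⊆E x∈E ⟩
    r M (G ∪ ⁅ x ⁆) + r M F   ∎)
  where open ≤-Reasoning

∖-isFlat : (M : Matroid) {F : Subset (n M)} (e : Fin (n M)) → IsFlat M F → IsFlat (M ∖ e) (F ∩ ∁ ⁅ e ⁆)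
∖-isFlat M {F} e fl@(F⊆E , _) = F-e⊆E-e , F-e-closed
  where
  F-e⊆E-e : F ∩ ∁ ⁅ e ⁆ ⊆ E M ∩ ∁ ⁅ e ⁆
  F-e⊆E-e x∈F-e with x∈p∩q⁻ F _ x∈F-e
  ... | x∈F , x≠e = x∈p∩q⁺ (F⊆E x∈F , x≠e)
  F-e-closed : ∀ x → x ∈ E M ∩ ∁ ⁅ e ⁆ → x ∉ F ∩ ∁ ⁅ e ⁆ →
               r M (F ∩ ∁ ⁅ e ⁆) < r M ((F ∩ ∁ ⁅ e ⁆) ∪ ⁅ x ⁆)
  F-e-closed x x∈E-e x∉F-e with x∈p∩q⁻ (E M) _ x∈E-e
  ... | x∈E , x≠e = ⊆-flat⇒rank-increases M fl (p∩q⊆p F _) x∈E (λ x∈F → x∉F-e (x∈p∩q⁺ (x∈F , x≠e)))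

∖-restrict-≅ : (M : Matroid) {F : Subset (n M)} (e : Fin (n M))
  (F-e⊆E-e : F ∩ ∁ ⁅ e ⁆ ⊆ E (M ∖ e)) (F⊆E : F ⊆ E M) →
  restrict (M ∖ e) (F ∩ ∁ ⁅ e ⁆) F-e⊆E-e ≅ (restrict M F F⊆E ∖ e)
∖-restrict-≅ M e _ _ = record
  { φ = λ x → x ; ψ = λ x → x ; φ∈ = λ _ x∈ → x∈ ; ψ∈ = λ _ x∈ → x∈
  ; ψφ = λ _ _ → refl ; φψ = λ _ _ → refl
  ; rk = λ X X⊆F-e → cong (r M) (tabulate∘lookup-∩ X⊆F-e) }

∖-∉-≅ : (M : Matroid) {e : Fin (n M)} → e ∉ E M → (M ∖ e) ≅ M
∖-∉-≅ M {e} e∉E = record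
  { φ = λ x → x ; ψ = λ x → x ; φ∈ = λ _ → E-e⊆E ; ψ∈ = λ _ → E⊆E-e
  ; ψφ = λ _ _ → refl ; φψ = λ _ _ → refl
  ; rk = λ X X⊆E-e → cong (r M) (tabulate∘lookup-∩ (λ x∈X → E-e⊆E (X⊆E-e x∈X))) }
  where
  E-e⊆E : E M ∩ ∁ ⁅ e ⁆ ⊆ E M
  E-e⊆E = p∩q⊆p (E M) _
  E⊆E-e : E M ⊆ E M ∩ ∁ ⁅ e ⁆
  E⊆E-e x∈E = x∈p∩q⁺ (x∈E , x∉p⇒x∈∁p (λ x∈⁅e⁆ → e∉E (subst (_∈ E M) (x∈⁅y⁆⇒x≡y e x∈⁅e⁆) x∈E)))

lemma2p1 : (𝓜 : Class) → IsoClosed 𝓜 → OfSimple 𝓜 → Hereditary 𝓜 → Hereditary (Ext 𝓜)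
lemma2p1 𝓜 iso _ her M (simple , member) (F , fl@(F⊆E , _)) =
  restrict-simple M F⊆E simple , restricted-member member
  where
  restricted-deletion : ∀ e → 𝓜 (M ∖ e) → 𝓜 (restrict M F F⊆E ∖ e)
  restricted-deletion e M-e∈𝓜 =
    iso _ _ (∖-restrict-≅ M e (proj₁ F-e-flat) F⊆E) (her (M ∖ e) M-e∈𝓜 (F ∩ ∁ ⁅ e ⁆ , F-e-flat))
    where
    F-e-flat : IsFlat (M ∖ e) (F ∩ ∁ ⁅ e ⁆)
    F-e-flat = ∖-isFlat M e fl

  restricted-member : 𝓜 M ⊎ Σ (Fin (n M)) (λ e → e ∈ E M × 𝓜 (M ∖ e)) →
                      𝓜 (restrict M F F⊆E) ⊎ Σ (Fin (n M)) (λ e → e ∈ F × 𝓜 (restrict M F F⊆E ∖ e))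
  restricted-member (inj₁ M∈𝓜) = inj₁ (her M M∈𝓜 (F , fl))
  restricted-member (inj₂ (e , _ , M-e∈𝓜)) with e ∈? F
  ... | yes e∈F = inj₂ (e , e∈F , restricted-deletion e M-e∈𝓜)
  ... | no  e∉F = inj₁ (iso _ _ (∖-∉-≅ (restrict M F F⊆E) e∉F) (restricted-deletion e M-e∈𝓜))
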